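{- Let $\Gamma$ be a set of clauses. If $\Gamma$ has a regWRTL refutation $R$, then $\Gamma$ has a pool resolution refutation $R'$ whose size is no greater than the size of $R$.
   Context: A literal is a variable $x$ or its negation $\overline{x}$; a clause is a set of literals. Given clauses $A,B$ and a variable $x$ with $\overline{x}\notin A$, $x\notin B$: the resolution rule (requires $x\in A,\overline{x}\in B$) infers $(A\setminus\{x\})\cup(B\setminus\{\overline{x}\})$; the degenerate resolution rule infers this same clause if $x\in A$ and $\overline x\in B$, infers $B$ if $x\in A,\overline{x}\notin B$, infers $A$ if $x\notin A,\overline{x}\in B$, and otherwise infers either $A$ or $B$; the w-resolution rule always infers $(A\setminus\{x\})\cup(B\setminus\{\overline{x}\})$. Given a tree $T$, the postorder $<_T$: if $v$ is in the subtree of the left child of $u$ and $w$ in the subtree of the right child of $u$, then $v<_T w<_T u$. A regRTL derivation of $C$ from $\Gamma$ is a tree in which each internal node is labeled by a clause and a variable, the clause obtained by resolution on that variable from its children's clauses; each leaf is labeled by a clause of $\Gamma$ or by a clause appearing earlier in the tree in the postorder (a lemma); no variable is used as resolution variable twice on any root-to-leaf path; and the root is labeled $C$. A refutation derives the empty clause. A regWRTL derivation is the same but allowing w-resolution inferences; a pool resolution derivation is the same but allowing degenerate resolution inferences. Size is the number of clauses. -}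

module Defs where

open import Data.Nat using (ℕ; suc; _+_)
open import Data.List using (List; []; _∷_; _++_)
open import Data.List.Membership.Propositional using (_∈_; _∉_)
open import Data.List.Relation.Unary.Any using (Any)
open import Data.Product using (Σ; _×_; _,_)
open import Data.Sum using (_⊎_)
open import Relation.Binary.PropositionalEquality using (_≡_; _≢_)
open import Function.Bundles using (_⇔_)

data Lit : Set where
  pos : ℕ → Lit
  neg : ℕ → Lit

-- A clause is a (finite) set of literals, represented by a list read as a set:
-- two clauses are equal iff they have the same members.
Clause : Set
Clause = List Lit

_≈_ : Clause → Clause → Set
C ≈ D = ∀ ℓ → (ℓ ∈ C) ⇔ (ℓ ∈ D)

IsResolvent : Clause → Clause → ℕ → Clause → Set
IsResolvent A B x C = ∀ ℓ → (ℓ ∈ C) ⇔ ((ℓ ∈ A × ℓ ≢ pos x) ⊎ (ℓ ∈ B × ℓ ≢ neg x))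

-- An inference rule: Rule A B x C means "C is inferred from A and B on x".
Rule : Set₁
Rule = Clause → Clause → ℕ → Clause → Set

SideCond : Clause → Clause → ℕ → Set
SideCond A B x = neg x ∉ A × pos x ∉ B

Res : Rule
Res A B x C = SideCond A B x × pos x ∈ A × neg x ∈ B × IsResolvent A B x C

WRes : Rule
WRes A B x C = SideCond A B x × IsResolvent A B x C

DegRes : Rule
DegRes A B x C = SideCond A B x ×
  ( (pos x ∈ A × neg x ∈ B × IsResolvent A B x C)
  ⊎ (pos x ∈ A × neg x ∉ B × C ≈ B)
  ⊎ (pos x ∉ A × neg x ∈ B × C ≈ A)
  ⊎ (pos x ∉ A × neg x ∉ B × (C ≈ A ⊎ C ≈ B)) )

RegWRTLRule : Rule
RegWRTLRule A B x C = Res A B x C ⊎ WRes A B x C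

PoolRule : Rule
PoolRule A B x C = Res A B x C ⊎ DegRes A B x C

data Tree : Set where
  leaf : Clause → Tree
  node : Clause → ℕ → Tree → Tree → Tree

label : Tree → Clause
label (leaf C) = C
label (node C _ _ _) = C

postorder : Tree → List Clause
postorder (leaf C) = C ∷ []
postorder (node C _ l r) = postorder l ++ postorder r ++ (C ∷ [])

size : Tree → ℕ
size (leaf _) = 1
size (node _ _ l r) = suc (size l + size r)

-- WellFormed Γ R path earlier T: T is a correct subderivation, where
--  * path    = resolution variables used on the path from the root to T
--              (regularity: none may be reused below),
--  * earlier = the clause labels of the whole tree preceding T in postorder
--              (available as lemmas at leaves of T).
-- Each internal node's clause is inferred by R from its two children's clauses
-- (in either order, the rule not fixing which premise is the left child).
data WellFormed (Γ : Clause → Set) (R : Rule)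
       : List ℕ → List Clause → Tree → Set where
  leafΓ     : ∀ {path earlier C} D → Γ D → D ≈ C →
              WellFormed Γ R path earlier (leaf C)
  leafLemma : ∀ {path earlier C} → Any (_≈ C) earlier →
              WellFormed Γ R path earlier (leaf C)
  inner     : ∀ {path earlier C x l r} →
              x ∉ path →
              WellFormed Γ R (x ∷ path) earlier l →
              WellFormed Γ R (x ∷ path) (earlier ++ postorder l) r →
              (R (label l) (label r) x C ⊎ R (label r) (label l) x C) →
              WellFormed Γ R path earlier (node C x l r)

Refutation : (Clause → Set) → Rule → Tree → Set
Refutation Γ R T = WellFormed Γ R [] [] T × label T ≈ []

-- Keep the shape of the regWRTL refutation and relabel it bottom-up: a node whose
-- children now carry subclauses A′ ⊆ A, B′ ⊆ B gets the clause that the pool rule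
-- infers from A′, B′ — their resolvent if both contain the clashing literals,
-- otherwise the premise lacking its clashing literal.  Either way this is a
-- subclause of the w-resolvent of A and B.  Lemma leaves keep their postorder
-- position, and the clause at that position has only shrunk, so it is again
-- available as a lemma.  The root becomes a subclause of the empty clause.
module Submission where

open import Defs
open import Data.Nat using (ℕ; suc; _+_; _≤_)
import Data.Nat as ℕ
open import Data.Nat.Properties using (≤-reflexive)
open import Data.Product using (Σ; _×_; _,_)
open import Data.Sum using (_⊎_; inj₁; inj₂; [_,_]′)
open import Data.List using (List; []; _∷_; _++_; filter)
open import Data.List.Membership.Propositional using (_∈_; _∉_)
open import Data.List.Membership.Propositional.Properties
  using (∈-++⁺ˡ; ∈-++⁺ʳ; ∈-++⁻; ∈-filter⁺; ∈-filter⁻)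
open import Data.List.Relation.Binary.Subset.Propositional using (_⊆_)
open import Data.List.Relation.Unary.Any using (Any; here; there)
open import Data.List.Relation.Binary.Pointwise using (Pointwise; []; _∷_; ++⁺)
open import Relation.Binary.Definitions using (DecidableEquality)
open import Relation.Binary.PropositionalEquality using (_≡_; _≢_; refl; cong; cong₂)
open import Relation.Nullary using (Dec; yes; no; ¬?)
import Relation.Nullary.Decidable as Dec
open import Function.Bundles using (mk⇔; Equivalence)

open Equivalence

_≟ˡ_ : DecidableEquality Lit
pos m ≟ˡ pos n = Dec.map′ (cong pos) (λ { refl → refl }) (m ℕ.≟ n)
pos m ≟ˡ neg n = no λ ()
neg m ≟ˡ pos n = no λ ()
neg m ≟ˡ neg n = Dec.map′ (cong neg) (λ { refl → refl }) (m ℕ.≟ n)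

open import Data.List.Membership.DecPropositional _≟ˡ_ using (_∈?_)

≈-refl : ∀ {C} → C ≈ C
≈-refl ℓ = mk⇔ (λ p → p) (λ p → p)

⊆-≈-[] : ∀ {C D} → C ⊆ D → D ≈ [] → C ≈ []
⊆-≈-[] C⊆D D≈[] ℓ = mk⇔ (λ p → to (D≈[] ℓ) (C⊆D p)) (λ ())

without : Lit → Clause → Clause
without ℓ = filter (λ k → ¬? (k ≟ˡ ℓ))

resolvent : Clause → Clause → ℕ → Clause
resolvent A B x = without (pos x) A ++ without (neg x) B

resolvent-isResolvent : ∀ A B x → IsResolvent A B x (resolvent A B x)
resolvent-isResolvent A B x ℓ = mk⇔ sound complete
  where
  sound : ℓ ∈ resolvent A B x → (ℓ ∈ A × ℓ ≢ pos x) ⊎ (ℓ ∈ B × ℓ ≢ neg x)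
  sound p with ∈-++⁻ (without (pos x) A) p
  ... | inj₁ q = inj₁ (∈-filter⁻ (λ k → ¬? (k ≟ˡ pos x)) q)
  ... | inj₂ q = inj₂ (∈-filter⁻ (λ k → ¬? (k ≟ˡ neg x)) q)
  complete : (ℓ ∈ A × ℓ ≢ pos x) ⊎ (ℓ ∈ B × ℓ ≢ neg x) → ℓ ∈ resolvent A B x
  complete (inj₁ (p , ne)) = ∈-++⁺ˡ (∈-filter⁺ (λ k → ¬? (k ≟ˡ pos x)) p ne)
  complete (inj₂ (p , ne)) =
    ∈-++⁺ʳ (without (pos x) A) (∈-filter⁺ (λ k → ¬? (k ≟ˡ neg x)) p ne)

module _ {A B A′ B′ : Clause} {x : ℕ} (A′⊆A : A′ ⊆ A) (B′⊆B : B′ ⊆ B) where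

  sideCond-⊆ : SideCond A B x → SideCond A′ B′ x
  sideCond-⊆ (x̄∉A , x∉B) = (λ p → x̄∉A (A′⊆A p)) , (λ p → x∉B (B′⊆B p))

  module _ {C : Clause} (C-res : IsResolvent A B x C) where

    ⊆-resolventˡ : pos x ∉ A′ → A′ ⊆ C
    ⊆-resolventˡ x∉A′ p = from (C-res _) (inj₁ (A′⊆A p , λ { refl → x∉A′ p }))

    ⊆-resolventʳ : neg x ∉ B′ → B′ ⊆ C
    ⊆-resolventʳ x̄∉B′ p = from (C-res _) (inj₂ (B′⊆B p , λ { refl → x̄∉B′ p }))

    resolvent-mono : ∀ {C′} → IsResolvent A′ B′ x C′ → C′ ⊆ C
    resolvent-mono C′-res p = from (C-res _)
      ([ (λ (q , ne) → inj₁ (A′⊆A q , ne)) , (λ (q , ne) → inj₂ (B′⊆B q , ne)) ]′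
       (to (C′-res _) p))

poolRule-⊆-wResolvent : ∀ {A B x C A′ B′} → SideCond A B x → IsResolvent A B x C →
  A′ ⊆ A → B′ ⊆ B → Σ Clause λ C′ → PoolRule A′ B′ x C′ × C′ ⊆ C
poolRule-⊆-wResolvent {x = x} {C = C} {A′} {B′} side C-res A′⊆A B′⊆B =
  infer (pos x ∈? A′) (neg x ∈? B′)
  where
  side′ : SideCond A′ B′ x
  side′ = sideCond-⊆ A′⊆A B′⊆B side

  infer : Dec (pos x ∈ A′) → Dec (neg x ∈ B′) → Σ Clause λ C′ → PoolRule A′ B′ x C′ × C′ ⊆ C
  infer (yes x∈A′) (yes x̄∈B′) =
    resolvent A′ B′ x , inj₁ (side′ , x∈A′ , x̄∈B′ , resolvent-isResolvent A′ B′ x) ,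
    resolvent-mono A′⊆A B′⊆B C-res (resolvent-isResolvent A′ B′ x)
  infer (yes x∈A′) (no x̄∉B′) =
    B′ , inj₂ (side′ , inj₂ (inj₁ (x∈A′ , x̄∉B′ , ≈-refl))) ,
    ⊆-resolventʳ A′⊆A B′⊆B C-res x̄∉B′
  infer (no x∉A′) (yes x̄∈B′) =
    A′ , inj₂ (side′ , inj₂ (inj₂ (inj₁ (x∉A′ , x̄∈B′ , ≈-refl)))) ,
    ⊆-resolventˡ A′⊆A B′⊆B C-res x∉A′
  infer (no x∉A′) (no x̄∉B′) =
    A′ , inj₂ (side′ , inj₂ (inj₂ (inj₂ (x∉A′ , x̄∉B′ , inj₁ ≈-refl)))) ,
    ⊆-resolventˡ A′⊆A B′⊆B C-res x∉A′

regWRTLRule⇒wResolvent : ∀ {A B x C} → RegWRTLRule A B x C →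
  SideCond A B x × IsResolvent A B x C
regWRTLRule⇒wResolvent (inj₁ (side , _ , _ , C-res)) = side , C-res
regWRTLRule⇒wResolvent (inj₂ w)                      = w

poolRule-⊆-regWRTLRule : ∀ {A B x C A′ B′} → RegWRTLRule A B x C →
  A′ ⊆ A → B′ ⊆ B → Σ Clause λ C′ → PoolRule A′ B′ x C′ × C′ ⊆ C
poolRule-⊆-regWRTLRule rule =
  let side , C-res = regWRTLRule⇒wResolvent rule in poolRule-⊆-wResolvent side C-res

poolRule-⊆-either : ∀ {A B x C A′ B′} → RegWRTLRule A B x C ⊎ RegWRTLRule B A x C →
  A′ ⊆ A → B′ ⊆ B → Σ Clause λ C′ → (PoolRule A′ B′ x C′ ⊎ PoolRule B′ A′ x C′) × C′ ⊆ C
poolRule-⊆-either (inj₁ rule) A′⊆A B′⊆B =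
  let C′ , inference , C′⊆C = poolRule-⊆-regWRTLRule rule A′⊆A B′⊆B in
  C′ , inj₁ inference , C′⊆C
poolRule-⊆-either (inj₂ rule) A′⊆A B′⊆B =
  let C′ , inference , C′⊆C = poolRule-⊆-regWRTLRule rule B′⊆B A′⊆A in
  C′ , inj₂ inference , C′⊆C

earlierLemma-⊆ : ∀ {earlier′ earlier C} → Pointwise _⊆_ earlier′ earlier → Any (_≈ C) earlier →
  Σ Clause λ D → Any (_≈ D) earlier′ × D ⊆ C
earlierLemma-⊆ (_∷_ {x = D} D⊆E _) (here E≈C) = D , here ≈-refl , λ p → to (E≈C _) (D⊆E p)
earlierLemma-⊆ (_ ∷ rest) (there a) =
  let D , a′ , D⊆C = earlierLemma-⊆ rest a in D , there a′ , D⊆C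

record PoolShrinking (Γ : Clause → Set) (path : List ℕ) (earlier′ : List Clause)
                     (T : Tree) : Set where
  constructor shrunk
  field
    tree         : Tree
    wellFormed   : WellFormed Γ PoolRule path earlier′ tree
    label-⊆      : label tree ⊆ label T
    size-≡       : size tree ≡ size T
    postorder-⊆  : Pointwise _⊆_ (postorder tree) (postorder T)

regWRTL⇒pool : ∀ {Γ path earlier earlier′ T} → WellFormed Γ RegWRTLRule path earlier T →
  Pointwise _⊆_ earlier′ earlier → PoolShrinking Γ path earlier′ T
regWRTL⇒pool {T = leaf C} (leafΓ D D∈Γ D≈C) _ =
  shrunk (leaf C) (leafΓ D D∈Γ D≈C) (λ p → p) refl ((λ p → p) ∷ [])
regWRTL⇒pool {T = leaf C} (leafLemma a) earlier⊆ =
  let D , a′ , D⊆C = earlierLemma-⊆ earlier⊆ a in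
  shrunk (leaf D) (leafLemma a′) D⊆C refl (D⊆C ∷ [])
regWRTL⇒pool {T = node C x l r} (inner x∉path wl wr rule) earlier⊆
  with regWRTL⇒pool wl earlier⊆
... | shrunk l′ wl′ l′⊆l |l′|≡|l| post-l′⊆
  with regWRTL⇒pool wr (++⁺ earlier⊆ post-l′⊆)
... | shrunk r′ wr′ r′⊆r |r′|≡|r| post-r′⊆
  with poolRule-⊆-either rule l′⊆l r′⊆r
... | C′ , inference , C′⊆C =
  shrunk (node C′ x l′ r′) (inner x∉path wl′ wr′ inference) C′⊆C
    (cong₂ (λ m n → suc (m + n)) |l′|≡|l| |r′|≡|r|)
    (++⁺ post-l′⊆ (++⁺ post-r′⊆ (C′⊆C ∷ [])))

proposition1p8 : (Γ : Clause → Set) (R : Tree) → Refutation Γ RegWRTLRule R →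
    Σ Tree (λ R′ → Refutation Γ PoolRule R′ × size R′ ≤ size R)
proposition1p8 Γ R (wf , root≈[]) =
  let shrunk R′ wf′ root⊆ |R′|≡|R| _ = regWRTL⇒pool wf [] in
  R′ , (wf′ , ⊆-≈-[] root⊆ root≈[]) , ≤-reflexive |R′|≡|R|
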